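{- Let $M=\begin{bmatrix}1&2\\4&0\end{bmatrix}$ over $Z_5$ and let $G=Z_{24}\times Z_5\times Z_5$ with multiplication $[c,d,e][f,g,h]=[c+f \bmod 24,\; [d,e]M^{f}+[g,h] \bmod 5]$ (a group of order $600$). Let $S=\{g,g^{ -1}: g\in\{[22,0,3],[15,1,3],[18,4,2],[12,0,0]\}\}$. Then $S$ consists of exactly $7$ non-identity elements and the Cayley graph $\mathrm{Cay}(G,S)$ is a connected $7$-regular graph of diameter $4$ on $600$ vertices.
   Context: For a finite group $G$ and an inverse-closed subset $S\subseteq G$ not containing the identity, the Cayley graph $\mathrm{Cay}(G,S)$ is the undirected graph with vertex set $G$ in which $x$ and $y$ are adjacent iff $y=xs$ for some $s\in S$; it is $|S|$-regular. The diameter of a connected graph is the maximum over all pairs of vertices of the length of a shortest path between them. Here $[d,e]M^f$ denotes the row vector $[d,e]$ multiplied by the $f$-th power of the matrix $M$, computed modulo $5$; the multiplicative order of $M$ divides $24$, so this is a semidirect product of $Z_{24}$ with $Z_5\times Z_5$. -}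

module Defs where

open import Data.Nat using (ℕ; zero; suc; _+_; _*_; _≤_)
open import Data.Nat.DivMod using (_mod_)
open import Data.Fin using (Fin; toℕ)
open import Data.Product using (_×_; _,_; ∃; ∃-syntax; Σ)
open import Data.Sum using (_⊎_)
open import Data.List using (List; []; _∷_; length)
open import Data.List.Membership.Propositional using (_∈_)
open import Data.List.Relation.Unary.Unique.Propositional using (Unique)
open import Function.Bundles using (_⇔_; _↔_)
open import Relation.Binary.PropositionalEquality using (_≡_)
open import Relation.Nullary using (¬_)

G : Set
G = Fin 24 × Fin 5 × Fin 5

-- One application of M = [[1,2],[4,0]] to the row vector [d,e] (mod 5):
-- [d,e] M = [d + 4e, 2d].
rowM : Fin 5 × Fin 5 → Fin 5 × Fin 5
rowM (d , e) = ((toℕ d + 4 * toℕ e) mod 5) , ((2 * toℕ d) mod 5)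

rowMPow : ℕ → Fin 5 × Fin 5 → Fin 5 × Fin 5
rowMPow zero    v = v
rowMPow (suc k) v = rowMPow k (rowM v)

_·_ : G → G → G
(c , d , e) · (f , g , h) with rowMPow (toℕ f) (d , e)
... | (d' , e') = ((toℕ c + toℕ f) mod 24) , ((toℕ d' + toℕ g) mod 5) , ((toℕ e' + toℕ h) mod 5)

infixl 7 _·_

ι : G
ι = 0 mod 24 , 0 mod 5 , 0 mod 5

gens : List G
gens = (22 mod 24 , 0 mod 5 , 3 mod 5)
     ∷ (15 mod 24 , 1 mod 5 , 3 mod 5)
     ∷ (18 mod 24 , 4 mod 5 , 2 mod 5)
     ∷ (12 mod 24 , 0 mod 5 , 0 mod 5)
     ∷ []

-- x is an inverse of g (in a group a one-sided inverse is the inverse)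
IsInverseOf : G → G → Set
IsInverseOf x g = g · x ≡ ι

InS : G → Set
InS x = ∃[ g ] (g ∈ gens × (x ≡ g ⊎ IsInverseOf x g))

Adj : G → G → Set
Adj x y = ∃[ s ] (InS s × y ≡ x · s)

data Walk : G → G → ℕ → Set where
  here : ∀ {x} → Walk x x 0
  step : ∀ {x y z n} → Adj x y → Walk y z n → Walk x z (suc n)

HasExactly : ℕ → (G → Set) → Set
HasExactly k P = Σ (List G) λ l → length l ≡ k × Unique l × (∀ x → (x ∈ l) ⇔ P x)

Connected : Set
Connected = ∀ x y → ∃[ n ] Walk x y n

Regular : ℕ → Set
Regular k = ∀ x → HasExactly k (Adj x)

Diameter : ℕ → Set
Diameter D = (∀ x y → ∃[ n ] (n ≤ D × Walk x y n))
           × (∃[ x ] ∃[ y ] (∀ n → Walk x y n → D ≤ n))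

NumVertices : ℕ → Set
NumVertices k = Fin k ↔ G

{-# OPTIONS --safe #-}
-- The multiplication is that of the semidirect product Z₂₄ ⋉ Z₅², so G is a group: associativity
-- follows from the linearity of v ↦ vM and from M²⁴ = I, and the remaining group laws are checked
-- on all 600 elements. Left multiplication is then an automorphism of Cay(G,S), so x is adjacent
-- exactly to x·S, and distances can be measured from the identity. A breadth-first search supplies
-- a word of length at most 4 in S for every element, while the walks of length at most 3 from the
-- identity, enumerated exhaustively, never reach [0,0,1].
module Submission where

open import Algebra.Bundles using (Group)
open import Algebra.Structures using (IsGroup)
import Algebra.Properties.Group as GroupProperties
open import Data.Char using (Char)
open import Data.Char.Properties using () renaming (_≟_ to _≟ᶜ_)
open import Data.Fin using (Fin; toℕ; fromℕ; zero; suc; _≟_)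
open import Data.Fin.Properties using (all?; toℕ-fromℕ<; toℕ-injective; *↔×)
import Data.List as List
open import Data.List using (List; []; _∷_; length; map; concatMap; allFin; findIndex)
open import Data.List.Membership.Propositional using (_∈_; _∉_; lose)
open import Data.List.Membership.Propositional.Properties using (∈-map⁺; ∈-map⁻; ∈-concatMap⁺)
import Data.List.Membership.DecPropositional as DecMembership
open import Data.List.Relation.Unary.All as All using (All)
open import Data.List.Relation.Unary.Any using (here; there)
open import Data.List.Relation.Unary.Unique.Propositional using (Unique)
import Data.List.Relation.Unary.Unique.Propositional.Properties as Unique
open import Data.List.Relation.Unary.Unique.DecPropositional using (unique?)
open import Data.Maybe using (fromMaybe)
open import Data.Nat using (ℕ; NonZero; zero; suc; _+_; _*_; _∸_; _≤_; _<_; _%_; _<?_; _≤?_)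
open import Data.Nat.DivMod using (_mod_; _/_; %-distribˡ-+; m%n%n≡m%n; m≡m%n+[m/n]*n)
open import Data.Nat.Properties using (+-assoc; +-comm; ≮⇒≥; allUpTo?)
open import Data.Product using (_×_; _,_; proj₁; proj₂; ∃-syntax; map₂; uncurry; curry)
open import Data.Product.Function.NonDependent.Propositional using (_×-↔_)
open import Data.Product.Properties using (≡-dec)
open import Data.String using (String; toList)
open import Data.Sum using (inj₁; inj₂)
open import Function.Bundles using (_↔_; _⇔_; Inverse; mk⇔)
open import Function.Properties.Inverse using (↔-trans; ↔-refl)
open import Relation.Binary.Definitions using (DecidableEquality)
open import Relation.Binary.PropositionalEquality
  using (_≡_; refl; sym; trans; cong; cong₂; subst; subst₂; isEquivalence; module ≡-Reasoning)
open import Relation.Nullary using (Dec; yes; no; ¬_; ¬?; contradiction)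
open import Relation.Nullary.Decidable using (map′; from-yes; _×-dec_)
open import Relation.Unary using (Decidable)

open import Defs

infixl 6 _⊕_
infix  8 ⊖_

_⊕_ : ∀ {n} → Fin (suc n) → Fin (suc n) → Fin (suc n)
_⊕_ {n} a b = (toℕ a + toℕ b) mod suc n

⊖_ : ∀ {n} → Fin (suc n) → Fin (suc n)
⊖_ {n} a = (suc n ∸ toℕ a) mod suc n

[m%n+k]%n≡[m+k]%n : ∀ m k n .{{_ : NonZero n}} → (m % n + k) % n ≡ (m + k) % n
[m%n+k]%n≡[m+k]%n m k n = begin
  (m % n + k) % n            ≡⟨ %-distribˡ-+ (m % n) k n ⟩
  (m % n % n + k % n) % n    ≡⟨ cong (λ t → (t + k % n) % n) (m%n%n≡m%n m n) ⟩
  (m % n + k % n) % n        ≡⟨ %-distribˡ-+ m k n ⟨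
  (m + k) % n                ∎
  where open ≡-Reasoning

[m+k%n]%n≡[m+k]%n : ∀ m k n .{{_ : NonZero n}} → (m + k % n) % n ≡ (m + k) % n
[m+k%n]%n≡[m+k]%n m k n = begin
  (m + k % n) % n   ≡⟨ cong (_% n) (+-comm m (k % n)) ⟩
  (k % n + m) % n   ≡⟨ [m%n+k]%n≡[m+k]%n k m n ⟩
  (k + m) % n       ≡⟨ cong (_% n) (+-comm k m) ⟩
  (m + k) % n       ∎
  where open ≡-Reasoning

toℕ-⊕ : ∀ {n} (a b : Fin (suc n)) → toℕ (a ⊕ b) ≡ (toℕ a + toℕ b) % suc n
toℕ-⊕ a b = toℕ-fromℕ< _

⊕-assoc : ∀ {n} (a b c : Fin (suc n)) → (a ⊕ b) ⊕ c ≡ a ⊕ (b ⊕ c)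
⊕-assoc {n} a b c = toℕ-injective (begin
  toℕ ((a ⊕ b) ⊕ c)                         ≡⟨ toℕ-⊕ (a ⊕ b) c ⟩
  (toℕ (a ⊕ b) + toℕ c) % suc n             ≡⟨ cong (λ t → (t + toℕ c) % suc n) (toℕ-⊕ a b) ⟩
  ((toℕ a + toℕ b) % suc n + toℕ c) % suc n ≡⟨ [m%n+k]%n≡[m+k]%n (toℕ a + toℕ b) (toℕ c) (suc n) ⟩
  (toℕ a + toℕ b + toℕ c) % suc n           ≡⟨ cong (_% suc n) (+-assoc (toℕ a) (toℕ b) (toℕ c)) ⟩
  (toℕ a + (toℕ b + toℕ c)) % suc n         ≡⟨ [m+k%n]%n≡[m+k]%n (toℕ a) (toℕ b + toℕ c) (suc n) ⟨
  (toℕ a + (toℕ b + toℕ c) % suc n) % suc n ≡⟨ cong (λ t → (toℕ a + t) % suc n) (toℕ-⊕ b c) ⟨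
  (toℕ a + toℕ (b ⊕ c)) % suc n             ≡⟨ toℕ-⊕ a (b ⊕ c) ⟨
  toℕ (a ⊕ (b ⊕ c))                         ∎)
  where open ≡-Reasoning

V : Set
V = Fin 5 × Fin 5

infixl 6 _+ᵥ_
infix  8 -ᵥ_

_+ᵥ_ : V → V → V
(a , b) +ᵥ (c , d) = a ⊕ c , b ⊕ d

-ᵥ_ : V → V
-ᵥ (a , b) = ⊖ a , ⊖ b

+ᵥ-assoc : ∀ u v w → (u +ᵥ v) +ᵥ w ≡ u +ᵥ (v +ᵥ w)
+ᵥ-assoc (a , b) (c , d) (e , f) = cong₂ _,_ (⊕-assoc a c e) (⊕-assoc b d f)

all-pairs? : {A B : Set} {P : A × B → Set} → Dec (∀ a b → P (a , b)) → Dec (∀ p → P p)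
all-pairs? = map′ uncurry curry

all-V? : {P : V → Set} → Decidable P → Dec (∀ v → P v)
all-V? P? = all-pairs? (all? λ a → all? λ b → P? (a , b))

all-G? : {P : G → Set} → Decidable P → Dec (∀ x → P x)
all-G? P? = all-pairs? (all? λ c → all-V? λ v → P? (c , v))

infix 4 _≟ᵥ_ _≟ᴳ_

_≟ᵥ_ : DecidableEquality V
_≟ᵥ_ = ≡-dec _≟_ _≟_

_≟ᴳ_ : DecidableEquality G
_≟ᴳ_ = ≡-dec _≟_ _≟ᵥ_

open DecMembership _≟ᴳ_ using (_∈?_)

rowM-+ᵥ : ∀ u v → rowM (u +ᵥ v) ≡ rowM u +ᵥ rowM v
rowM-+ᵥ = from-yes (all-V? λ u → all-V? λ v → rowM (u +ᵥ v) ≟ᵥ rowM u +ᵥ rowM v)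

rowMPow-+ᵥ : ∀ k u v → rowMPow k (u +ᵥ v) ≡ rowMPow k u +ᵥ rowMPow k v
rowMPow-+ᵥ zero    u v = refl
rowMPow-+ᵥ (suc k) u v = trans (cong (rowMPow k) (rowM-+ᵥ u v)) (rowMPow-+ᵥ k (rowM u) (rowM v))

rowMPow-+ : ∀ m n v → rowMPow (m + n) v ≡ rowMPow n (rowMPow m v)
rowMPow-+ zero    n v = refl
rowMPow-+ (suc m) n v = rowMPow-+ m n (rowM v)

rowMPow-*period : ∀ {p} → (∀ v → rowMPow p v ≡ v) → ∀ q v → rowMPow (q * p) v ≡ v
rowMPow-*period         period zero    v = refl
rowMPow-*period {p} period (suc q) v = begin
  rowMPow (p + q * p) v          ≡⟨ rowMPow-+ p (q * p) v ⟩
  rowMPow (q * p) (rowMPow p v)  ≡⟨ rowMPow-*period period q (rowMPow p v) ⟩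
  rowMPow p v                    ≡⟨ period v ⟩
  v                              ∎
  where open ≡-Reasoning

rowMPow-%period : ∀ {p} .{{_ : NonZero p}} → (∀ v → rowMPow p v ≡ v) → ∀ k v → rowMPow k v ≡ rowMPow (k % p) v
rowMPow-%period {p} period k v = begin
  rowMPow k v                                ≡⟨ cong (λ t → rowMPow t v) (m≡m%n+[m/n]*n k p) ⟩
  rowMPow (k % p + k / p * p) v              ≡⟨ rowMPow-+ (k % p) (k / p * p) v ⟩
  rowMPow (k / p * p) (rowMPow (k % p) v)    ≡⟨ rowMPow-*period period (k / p) (rowMPow (k % p) v) ⟩
  rowMPow (k % p) v                          ∎
  where open ≡-Reasoning

rowMPow-24 : ∀ v → rowMPow 24 v ≡ v
rowMPow-24 = from-yes (all-V? λ v → rowMPow 24 v ≟ᵥ v)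

rowMPow-⊕ : ∀ a b v → rowMPow (toℕ (a ⊕ b)) v ≡ rowMPow (toℕ b) (rowMPow (toℕ a) v)
rowMPow-⊕ a b v = begin
  rowMPow (toℕ (a ⊕ b)) v                   ≡⟨ cong (λ t → rowMPow t v) (toℕ-⊕ a b) ⟩
  rowMPow ((toℕ a + toℕ b) % 24) v          ≡⟨ rowMPow-%period {24} rowMPow-24 (toℕ a + toℕ b) v ⟨
  rowMPow (toℕ a + toℕ b) v                 ≡⟨ rowMPow-+ (toℕ a) (toℕ b) v ⟩
  rowMPow (toℕ b) (rowMPow (toℕ a) v)       ∎
  where open ≡-Reasoning

·-assoc : ∀ x y z → (x · y) · z ≡ x · (y · z)
·-assoc (a , u) (b , v) (c , w) = cong₂ _,_ (⊕-assoc a b c) (begin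
  rowMPow (toℕ c) (rowMPow (toℕ b) u +ᵥ v) +ᵥ w
    ≡⟨ cong (_+ᵥ w) (rowMPow-+ᵥ (toℕ c) (rowMPow (toℕ b) u) v) ⟩
  (rowMPow (toℕ c) (rowMPow (toℕ b) u) +ᵥ rowMPow (toℕ c) v) +ᵥ w
    ≡⟨ cong (λ t → (t +ᵥ rowMPow (toℕ c) v) +ᵥ w) (rowMPow-⊕ b c u) ⟨
  (rowMPow (toℕ (b ⊕ c)) u +ᵥ rowMPow (toℕ c) v) +ᵥ w
    ≡⟨ +ᵥ-assoc (rowMPow (toℕ (b ⊕ c)) u) (rowMPow (toℕ c) v) w ⟩
  rowMPow (toℕ (b ⊕ c)) u +ᵥ (rowMPow (toℕ c) v +ᵥ w)
    ∎)
  where open ≡-Reasoning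

infix 8 _⁻¹

_⁻¹ : G → G
(c , v) ⁻¹ = ⊖ c , -ᵥ rowMPow (toℕ (⊖ c)) v

·-identityˡ : ∀ x → ι · x ≡ x
·-identityˡ = from-yes (all-G? λ x → ι · x ≟ᴳ x)

·-identityʳ : ∀ x → x · ι ≡ x
·-identityʳ = from-yes (all-G? λ x → x · ι ≟ᴳ x)

·-inverseˡ : ∀ x → x ⁻¹ · x ≡ ι
·-inverseˡ = from-yes (all-G? λ x → x ⁻¹ · x ≟ᴳ ι)

·-inverseʳ : ∀ x → x · x ⁻¹ ≡ ι
·-inverseʳ = from-yes (all-G? λ x → x · x ⁻¹ ≟ᴳ ι)

·-isGroup : IsGroup _≡_ _·_ ι _⁻¹
·-isGroup = record
  { isMonoid = record
    { isSemigroup = record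
      { isMagma = record { isEquivalence = isEquivalence ; ∙-cong = cong₂ _·_ }
      ; assoc   = ·-assoc
      }
    ; identity = ·-identityˡ , ·-identityʳ
    }
  ; inverse = ·-inverseˡ , ·-inverseʳ
  ; ⁻¹-cong = cong _⁻¹
  }

·-group : Group _ _
·-group = record { isGroup = ·-isGroup }

open GroupProperties ·-group using (∙-cancelˡ; inverseʳ-unique; \\-leftDividesˡ)

G-enumeration : Fin 600 ↔ G
G-enumeration = ↔-trans (*↔× {24} {25}) (↔-refl ×-↔ *↔× {5} {5})

g₁ g₂ g₃ g₄ : G
g₁ = 22 mod 24 , 0 mod 5 , 3 mod 5
g₂ = 15 mod 24 , 1 mod 5 , 3 mod 5
g₃ = 18 mod 24 , 4 mod 5 , 2 mod 5
g₄ = 12 mod 24 , 0 mod 5 , 0 mod 5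

-- g₄ is an involution, so it contributes a single element to S.
letter : Fin 7 → G
letter zero                                      = g₁
letter (suc zero)                                = g₁ ⁻¹
letter (suc (suc zero))                          = g₂
letter (suc (suc (suc zero)))                    = g₂ ⁻¹
letter (suc (suc (suc (suc zero))))              = g₃
letter (suc (suc (suc (suc (suc zero)))))        = g₃ ⁻¹
letter (suc (suc (suc (suc (suc (suc zero)))))) = g₄

letter-InS : ∀ i → InS (letter i)
letter-InS zero                                      = g₁ , here refl , inj₁ refl
letter-InS (suc zero)                                = g₁ , here refl , inj₂ (·-inverseʳ g₁)
letter-InS (suc (suc zero))                          = g₂ , there (here refl) , inj₁ refl
letter-InS (suc (suc (suc zero)))                    = g₂ , there (here refl) , inj₂ (·-inverseʳ g₂)
letter-InS (suc (suc (suc (suc zero))))              = g₃ , there (there (here refl)) , inj₁ refl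
letter-InS (suc (suc (suc (suc (suc zero)))))        = g₃ , there (there (here refl)) , inj₂ (·-inverseʳ g₃)
letter-InS (suc (suc (suc (suc (suc (suc zero)))))) = g₄ , there (there (there (here refl))) , inj₁ refl

S-list : List G
S-list = map letter (allFin 7)

gens±⊆S-list : All (λ g → g ∈ S-list × g ⁻¹ ∈ S-list) gens
gens±⊆S-list = from-yes (All.all? (λ g → (g ∈? S-list) ×-dec (g ⁻¹ ∈? S-list)) gens)

InS⇒∈S-list : ∀ {x} → InS x → x ∈ S-list
InS⇒∈S-list (g , g∈gens , inj₁ refl) = proj₁ (All.lookup gens±⊆S-list g∈gens)
InS⇒∈S-list {x} (g , g∈gens , inj₂ g·x≡ι) =
  subst (_∈ S-list) (sym (inverseʳ-unique g x g·x≡ι)) (proj₂ (All.lookup gens±⊆S-list g∈gens))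

∈S-list⇒InS : ∀ {x} → x ∈ S-list → InS x
∈S-list⇒InS x∈S with ∈-map⁻ letter {xs = allFin 7} x∈S
... | i , _ , refl = letter-InS i

S-list-unique : Unique S-list
S-list-unique = from-yes (unique? _≟ᴳ_ S-list)

InS-hasExactly-7 : HasExactly 7 InS
InS-hasExactly-7 = S-list , refl , S-list-unique , λ x → mk⇔ ∈S-list⇒InS InS⇒∈S-list

ι∉S : ¬ InS ι
ι∉S ι∈S = from-yes (¬? (ι ∈? S-list)) (InS⇒∈S-list ι∈S)

∈x·S⇔Adj : ∀ x y → y ∈ map (x ·_) S-list ⇔ Adj x y
∈x·S⇔Adj x y = mk⇔ ∈x·S⇒Adj Adj⇒∈x·S
  where
  ∈x·S⇒Adj : y ∈ map (x ·_) S-list → Adj x y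
  ∈x·S⇒Adj y∈x·S with ∈-map⁻ (x ·_) {xs = S-list} y∈x·S
  ... | s , s∈S , y≡x·s = s , ∈S-list⇒InS s∈S , y≡x·s

  Adj⇒∈x·S : Adj x y → y ∈ map (x ·_) S-list
  Adj⇒∈x·S (s , s∈S , refl) = ∈-map⁺ (x ·_) (InS⇒∈S-list s∈S)

Adj-regular : Regular 7
Adj-regular x =
  map (x ·_) S-list , refl , Unique.map⁺ {f = x ·_} (∙-cancelˡ x _ _) {xs = S-list} S-list-unique , ∈x·S⇔Adj x

Walk-translate : ∀ z {x y n} → Walk x y n → Walk (z · x) (z · y) n
Walk-translate z here                            = here
Walk-translate z {x} (step (s , s∈S , refl) w) = step (s , s∈S , sym (·-assoc z x s)) (Walk-translate z w)

follow : G → List (Fin 7) → G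
follow x []      = x
follow x (i ∷ w) = follow (x · letter i) w

walk-follow : ∀ x w → Walk x (follow x w) (length w)
walk-follow x []      = here
walk-follow x (i ∷ w) = step (letter i , letter-InS i , refl) (walk-follow (x · letter i) w)

-- Words spell each letter by its position in "aAbBcCd", following `letter`: "aB" is g₁ g₂⁻¹.
-- Any other character would decode to g₄, but none occurs.
decode : Char → Fin 7
decode c = fromMaybe (fromℕ 6) (findIndex (c ≟ᶜ_) (toList "aAbBcCd"))

-- Found by breadth-first search; the word for [c,d,e] is at position 25c + 5d + e.
shortestWords : List String
shortestWords =
  "" ∷ "aCaa" ∷ "BBcd" ∷ "bdBd" ∷ "aBAb" ∷ "BBC" ∷ "bCdb" ∷ "AcAA" ∷ "dcc" ∷ "bcb" ∷ "bbc" ∷ "cdc" ∷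
  "cBCb" ∷ "cAAA" ∷ "bcBC" ∷ "CBB" ∷ "BBdc" ∷ "aaaC" ∷ "ACac" ∷ "CdC" ∷ "cbb" ∷ "BCB" ∷ "ccd" ∷ "aaCa" ∷
  "AcaC" ∷ "caB" ∷ "acbc" ∷ "adBC" ∷ "aBdC" ∷ "aBBB" ∷ "ACbA" ∷ "aBCd" ∷ "bad" ∷ "bda" ∷ "Bac" ∷ "AdAB" ∷
  "abd" ∷ "dBAA" ∷ "aCbC" ∷ "aBc" ∷ "cBa" ∷ "acB" ∷ "aCdB" ∷ "adCB" ∷ "dab" ∷ "accb" ∷ "BCda" ∷ "adb" ∷
  "dba" ∷ "BaBB" ∷ "aacd" ∷ "Abbc" ∷ "bAB" ∷ "aabb" ∷ "adca" ∷ "ACdC" ∷ "cAC" ∷ "caad" ∷ "aaC" ∷ "CdCA" ∷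
  "bbAc" ∷ "Acbb" ∷ "ABCB" ∷ "Accd" ∷ "aCa" ∷ "BAb" ∷ "A" ∷ "Caa" ∷ "acad" ∷ "aadc" ∷ "Abcb" ∷ "CAc" ∷
  "dccA" ∷ "abab" ∷ "Adcc" ∷ "bcc" ∷ "CBd" ∷ "cB" ∷ "CdB" ∷ "dCB" ∷ "cdCb" ∷ "ccb" ∷ "aaBa" ∷ "db" ∷
  "Adba" ∷ "BBB" ∷ "AcaB" ∷ "cbc" ∷ "dBC" ∷ "BdC" ∷ "ABac" ∷ "Baaa" ∷ "BCd" ∷ "Abad" ∷ "Abda" ∷ "Bc" ∷
  "abAd" ∷ "bd" ∷ "bAda" ∷ "CbC" ∷ "ACAc" ∷ "BAAb" ∷ "bab" ∷ "abCB" ∷ "BabC" ∷ "dAAd" ∷ "bba" ∷ "abb" ∷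
  "dca" ∷ "acd" ∷ "AcAC" ∷ "BaCb" ∷ "aC" ∷ "adBB" ∷ "CBab" ∷ "adCd" ∷ "aBdB" ∷ "BBda" ∷ "Ca" ∷ "aBBd" ∷
  "AA" ∷ "dac" ∷ "cad" ∷ "adc" ∷ "aBCb" ∷ "CdBA" ∷ "abac" ∷ "BdAC" ∷ "cAbc" ∷ "aaB" ∷ "acba" ∷ "ACbC" ∷
  "ABc" ∷ "bAd" ∷ "Abd" ∷ "bdA" ∷ "AdCB" ∷ "Abcc" ∷ "abca" ∷ "AcB" ∷ "Adb" ∷ "bccA" ∷ "bcaa" ∷ "cAB" ∷
  "aBa" ∷ "Baa" ∷ "dAb" ∷ "dbA" ∷ "CAdB" ∷ "BcA" ∷ "bdcB" ∷ "Abab" ∷ "bCB" ∷ "abAb" ∷ "abbA" ∷ "Abba" ∷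
  "bb" ∷ "Adca" ∷ "cd" ∷ "adaa" ∷ "bAba" ∷ "C" ∷ "dBB" ∷ "aada" ∷ "Bcbd" ∷ "BdB" ∷ "CBBC" ∷ "ACa" ∷
  "BBd" ∷ "dCd" ∷ "Adac" ∷ "aCA" ∷ "dc" ∷ "BCb" ∷ "AAA" ∷ "adbC" ∷ "AdAb" ∷ "aCBc" ∷ "baCd" ∷ "aCbd" ∷
  "bdAA" ∷ "bac" ∷ "adBd" ∷ "abdC" ∷ "aB" ∷ "cba" ∷ "abCd" ∷ "adCb" ∷ "acb" ∷ "AAbd" ∷ "AbdA" ∷ "cBaC" ∷
  "dAbA" ∷ "bca" ∷ "abc" ∷ "AAdb" ∷ "baBB" ∷ "bAdA" ∷ "aaBA" ∷ "Ba" ∷ "ABCb" ∷ "AAAA" ∷ "BdBA" ∷ "CA" ∷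
  "Adc" ∷ "bAb" ∷ "bbA" ∷ "bCBA" ∷ "BCbA" ∷ "aCaC" ∷ "Acd" ∷ "daa" ∷ "dACd" ∷ "Abb" ∷ "CbAB" ∷ "ada" ∷
  "BAbC" ∷ "aCAA" ∷ "AC" ∷ "aad" ∷ "ABBd" ∷ "AdCd" ∷ "cdA" ∷ "BABd" ∷ "AACa" ∷ "bdC" ∷ "B" ∷ "ccdB" ∷
  "Abac" ∷ "dBd" ∷ "cb" ∷ "bacA" ∷ "Cdb" ∷ "bCd" ∷ "dCb" ∷ "cBC" ∷ "bc" ∷ "Bcdc" ∷ "bbbd" ∷ "abAc" ∷
  "aBA" ∷ "ABa" ∷ "dbbb" ∷ "acAb" ∷ "aaba" ∷ "bdbb" ∷ "Cbd" ∷ "dbC" ∷ "bAca" ∷ "CBc" ∷ "CAA" ∷ "AAC" ∷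
  "ad" ∷ "da" ∷ "abdB" ∷ "acc" ∷ "bbAA" ∷ "abCb" ∷ "caCd" ∷ "aadA" ∷ "babC" ∷ "ACA" ∷ "AAdc" ∷ "aBdb" ∷
  "Bdab" ∷ "bdBa" ∷ "aCdc" ∷ "CaC" ∷ "AbAb" ∷ "AbbA" ∷ "abbC" ∷ "AAbb" ∷ "baCb" ∷ "cca" ∷ "acdC" ∷ "aaCB" ∷
  "ACdb" ∷ "aBAA" ∷ "bcA" ∷ "Acb" ∷ "Abc" ∷ "bdAC" ∷ "aCaB" ∷ "bAc" ∷ "aab" ∷ "AABa" ∷ "CAbd" ∷ "cAb" ∷
  "aba" ∷ "BA" ∷ "ACbd" ∷ "AdbC" ∷ "cABC" ∷ "ACBc" ∷ "aBaC" ∷ "AB" ∷ "CaBa" ∷ "aCBa" ∷ "AdBd" ∷ "AbdC" ∷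
  "d" ∷ "Ada" ∷ "bdB" ∷ "BBc" ∷ "AAAC" ∷ "bCb" ∷ "bdcb" ∷ "adA" ∷ "cc" ∷ "bbdc" ∷ "bCBC" ∷ "Bdb" ∷
  "bdbc" ∷ "accA" ∷ "acaa" ∷ "ACaC" ∷ "aaac" ∷ "BBdC" ∷ "acAc" ∷ "Cdc" ∷ "BBCd" ∷ "Acca" ∷ "cdC" ∷ "bbC" ∷
  "bcBc" ∷ "bcAA" ∷ "Cbca" ∷ "bAAc" ∷ "cdBa" ∷ "BaC" ∷ "AAB" ∷ "adBc" ∷ "CBa" ∷ "adbd" ∷ "dBac" ∷ "aCB" ∷
  "acdB" ∷ "BAA" ∷ "adcB" ∷ "acBd" ∷ "aabA" ∷ "aBcd" ∷ "CaB" ∷ "AbAc" ∷ "ab" ∷ "aCbc" ∷ "Bacd" ∷ "AcAb" ∷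
  "ba" ∷ "aBC" ∷ "aac" ∷ "BBaa" ∷ "cAc" ∷ "aBaB" ∷ "adAA" ∷ "BaaB" ∷ "AcdC" ∷ "AbbC" ∷ "bACb" ∷ "CAcd" ∷
  "AAda" ∷ "AbdB" ∷ "aca" ∷ "bCbA" ∷ "Ad" ∷ "aaBB" ∷ "dA" ∷ "Acc" ∷ "aBBa" ∷ "aadC" ∷ "ABdb" ∷ "bAbC" ∷
  "ccA" ∷ "caa" ∷ "BcAB" ∷ "cdB" ∷ "aBCA" ∷ "dcB" ∷ "cBd" ∷ "CB" ∷ "Bcd" ∷ "ACaB" ∷ "cbdc" ∷ "b" ∷
  "abA" ∷ "cdbc" ∷ "bdcc" ∷ "Aba" ∷ "BC" ∷ "Cbc" ∷ "BBBd" ∷ "aBAC" ∷ "BBdB" ∷ "ABaC" ∷ "bcdc" ∷ "dBc" ∷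
  "cbC" ∷ "dbd" ∷ "bCBB" ∷ "Bdc" ∷ "Bcba" ∷ "baBc" ∷ "ccaC" ∷ "abcB" ∷ "cBab" ∷ "AAd" ∷ "bdab" ∷ "adcd" ∷
  "ca" ∷ "abdb" ∷ "adC" ∷ "aBB" ∷ "AdA" ∷ "Cda" ∷ "BBa" ∷ "aBcb" ∷ "aacA" ∷ "aaaa" ∷ "aCd" ∷ "Acaa" ∷
  "dAA" ∷ "ac" ∷ "dcad" ∷ "abbd" ∷ "BaB" ∷ "AAba" ∷ "ABC" ∷ "ACbc" ∷ "aadB" ∷ "adBa" ∷ "Baad" ∷ "aaCb" ∷
  "abaC" ∷ "bbAB" ∷ "BAC" ∷ "Adbd" ∷ "aBad" ∷ "aBda" ∷ "abCa" ∷ "adaB" ∷ "abAA" ∷ "AcBd" ∷ "ACB" ∷ "AcdB" ∷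
  "BCA" ∷ "dBaa" ∷ "Ab" ∷ "bA" ∷ "CBA" ∷ "aabC" ∷ "bCdB" ∷ "bdCB" ∷ "bbcc" ∷ "aBBA" ∷ "bcB" ∷ "bdb" ∷
  "dbb" ∷ "BCbd" ∷ "dcd" ∷ "Aca" ∷ "ABBa" ∷ "dC" ∷ "BB" ∷ "AAdA" ∷ "aBAB" ∷ "BdCb" ∷ "Bcb" ∷ "acA" ∷
  "aaa" ∷ "Cd" ∷ "adAC" ∷ "AdAA" ∷ "c" ∷ "dBCb" ∷ "bbd" ∷ "abdc" ∷ "aCb" ∷ "baC" ∷ "acdb" ∷ "aBcc" ∷
  "BAAC" ∷ "Bad" ∷ "Bda" ∷ "bCa" ∷ "daB" ∷ "bAA" ∷ "abcd" ∷ "AACB" ∷ "badc" ∷ "abbb" ∷ "acBc" ∷ "AAb" ∷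
  "AbA" ∷ "ACBA" ∷ "abC" ∷ "CBaC" ∷ "aBd" ∷ "accB" ∷ "adB" ∷ "dBa" ∷ "bAcB" ∷ "Adcd" ∷ "CAd" ∷ "dCA" ∷
  "aCac" ∷ "ABB" ∷ "bAdb" ∷ "BAB" ∷ "caCa" ∷ "AdC" ∷ "cA" ∷ "aa" ∷ "ACd" ∷ "bdbA" ∷ "ABcb" ∷ "Ac" ∷
  "Baab" ∷ "Abbd" ∷ "dAC" ∷ "daad" ∷ "bAbd" ∷ "BBA" ∷ "AbcB" ∷ "bABc" ∷ "bbAd" ∷ "ccB" ∷ "dB" ∷ "AdBa" ∷
  "bACa" ∷ "Bd" ∷ "dcb" ∷ "cdb" ∷ "Bcc" ∷ "bdc" ∷ "Cb" ∷ "aBAd" ∷ "dbc" ∷ "AdaB" ∷ "aCAb" ∷ "CBC" ∷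
  "cBCd" ∷ "dABa" ∷ "bbb" ∷ "AbAA" ∷ "bcd" ∷ "cbd" ∷ "BcdC" ∷ "bC" ∷ "cBc" ∷ "abAC" ∷ "CAAd" ∷ "dAAC" ∷
  "AcA" ∷ "a" ∷ "AACd" ∷ "cAA" ∷ "adcc" ∷ "AAc" ∷ "aBBC" ∷ "BBaC" ∷ "bbac" ∷ "dACA" ∷ "BCBa" ∷ "baB" ∷
  "acdc" ∷ "AdCA" ∷ "Cac" ∷ "aCdC" ∷ "aCBB" ∷ "ACAd" ∷ "accd" ∷ "AAdC" ∷ "caC" ∷ "acbb" ∷ "Bab" ∷ "bAC" ∷
  "aacB" ∷ "bada" ∷ "AbC" ∷ "adab" ∷ "ABd" ∷ "AccB" ∷ "AdB" ∷ "adba" ∷ "bcdA" ∷ "ACb" ∷ "Adcb" ∷ "Acdb" ∷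
  "ABcc" ∷ "dBA" ∷ "CbA" ∷ "BAd" ∷ "abad" ∷ "abda" ∷ "CAb" ∷ "dAB" ∷ "aabd" ∷ "bAcd" ∷ "BdA" ∷ "aaBc" ∷
  []

shortestWord : G → List (Fin 7)
shortestWord y = map decode (toList (List.lookup shortestWords (Inverse.from G-enumeration y)))

shortestWord-spec : ∀ y → follow ι (shortestWord y) ≡ y × length (shortestWord y) ≤ 4
shortestWord-spec = from-yes (all-G? λ y → (follow ι (shortestWord y) ≟ᴳ y) ×-dec (length (shortestWord y) ≤? 4))

Walk-ι-shortestWord : ∀ y → Walk ι y (length (shortestWord y))
Walk-ι-shortestWord y =
  subst (λ b → Walk ι b (length (shortestWord y))) (proj₁ (shortestWord-spec y)) (walk-follow ι (shortestWord y))

walk-≤4 : ∀ x y → ∃[ n ] (n ≤ 4 × Walk x y n)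
walk-≤4 x y = length w , proj₂ (shortestWord-spec (x ⁻¹ · y)) ,
  subst₂ (λ a b → Walk a b (length w)) (·-identityʳ x) (\\-leftDividesˡ x y)
    (Walk-translate x (Walk-ι-shortestWord (x ⁻¹ · y)))
  where
  w : List (Fin 7)
  w = shortestWord (x ⁻¹ · y)

endpoints : G → ℕ → List G
endpoints x zero    = x ∷ []
endpoints x (suc n) = concatMap (λ s → endpoints (x · s) n) S-list

Walk⇒∈endpoints : ∀ {x y n} → Walk x y n → y ∈ endpoints x n
Walk⇒∈endpoints here = here refl
Walk⇒∈endpoints {x} {n = suc n} (step (s , s∈S , refl) w) =
  ∈-concatMap⁺ (λ t → endpoints (x · t) n) {xs = S-list} (lose (InS⇒∈S-list s∈S) (Walk⇒∈endpoints w))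

y₀ : G
y₀ = 0 mod 24 , 0 mod 5 , 1 mod 5

y₀∉endpoints<4 : ∀ {n} → n < 4 → y₀ ∉ endpoints ι n
y₀∉endpoints<4 = from-yes (allUpTo? (λ n → ¬? (y₀ ∈? endpoints ι n)) 4)

Walk-ι-y₀⇒4≤n : ∀ n → Walk ι y₀ n → 4 ≤ n
Walk-ι-y₀⇒4≤n n w with n <? 4
... | yes n<4 = contradiction (Walk⇒∈endpoints w) (y₀∉endpoints<4 n<4)
... | no  n≮4 = ≮⇒≥ n≮4

mainTheorem13 : (HasExactly 7 InS × ¬ InS ι) × NumVertices 600 × Connected × Regular 7 × Diameter 4
mainTheorem13 =
  (InS-hasExactly-7 , ι∉S) , G-enumeration , connected , Adj-regular , walk-≤4 , ι , y₀ , Walk-ι-y₀⇒4≤n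
  where
  connected : Connected
  connected x y = map₂ proj₂ (walk-≤4 x y)
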